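{- For every integer $n\geq 2$, the $n$-book graph satisfies $\chi_D(B_n)=\lceil\sqrt{n}\,\rceil+1$ or $\chi_D(B_n)=\lceil\sqrt{n}\,\rceil+2$. More precisely, writing $\lceil\sqrt{n}\,\rceil=m+1$ with $m\geq 1$ an integer: (i) $\chi_D(B_n)=\lceil\sqrt{n}\,\rceil+1$ whenever $m^2<n\leq m^2+m+1$; (ii) $\chi_D(B_n)=\lceil\sqrt{n}\,\rceil+2$ whenever $m^2+m+2\leq n\leq (m+1)^2$.
   Context: The $n$-book graph $B_n$ ($n\geq 2$) is the Cartesian product of the star $K_{1,n}$ and the path $P_2$ on two vertices; concretely it has vertices $v_0,w_0,v_1,w_1,\dots,v_n,w_n$ and edges $v_0w_0$, $v_0v_i$, $w_0w_i$, $v_iw_i$ for $1\leq i\leq n$. A vertex coloring is distinguishing if the only automorphism preserving all vertex colors is the identity. The distinguishing chromatic number $\chi_D(G)$ is the minimum $r$ such that $G$ has a proper distinguishing coloring with $r$ colors. -}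

module Defs where

open import Data.Nat using (ℕ; suc; _<_)
open import Data.Fin using (Fin; zero; suc)
open import Data.Product using (_×_; _,_; Σ; ∃)
open import Relation.Binary.PropositionalEquality using (_≡_; _≢_)
open import Relation.Nullary using (¬_)

-- Vertices of the n-book graph B_n.
-- (zero , i) is v_i and (suc zero , i) is w_i, for i : Fin (suc n) (i = 0..n).
BookV : ℕ → Set
BookV n = Fin 2 × Fin (suc n)

data Adj {n : ℕ} : BookV n → BookV n → Set where
  rung  : (i : Fin (suc n)) → Adj (zero , i) (suc zero , i)
  rung′ : (i : Fin (suc n)) → Adj (suc zero , i) (zero , i)
  spoke  : (s : Fin 2) (i : Fin n) → Adj (s , zero) (s , suc i)
  spoke′ : (s : Fin 2) (i : Fin n) → Adj (s , suc i) (s , zero)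

record Aut (n : ℕ) : Set where
  field
    to      : BookV n → BookV n
    from    : BookV n → BookV n
    from-to : ∀ x → from (to x) ≡ x
    to-from : ∀ y → to (from y) ≡ y
    adj→    : ∀ {x y} → Adj x y → Adj (to x) (to y)
    adj←    : ∀ {x y} → Adj (to x) (to y) → Adj x y

Coloring : ℕ → ℕ → Set
Coloring n r = BookV n → Fin r

Proper : ∀ {n r} → Coloring n r → Set
Proper {n} c = ∀ {x y : BookV n} → Adj x y → c x ≢ c y

Distinguishing : ∀ {n r} → Coloring n r → Set
Distinguishing {n} c =
  (σ : Aut n) → (∀ x → c (Aut.to σ x) ≡ c x) → ∀ x → Aut.to σ x ≡ x

HasPDC : ℕ → ℕ → Set
HasPDC n r = Σ (Coloring n r) λ c → Proper c × Distinguishing c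

ChiD≡ : ℕ → ℕ → Set
ChiD≡ n k = HasPDC n k × (∀ r → r < k → ¬ HasPDC n r)

{-# OPTIONS --safe #-}
-- Only the hubs v₀, w₀ have three distinct neighbours, so for n ≥ 2 an automorphism of B_n
-- fixes or swaps the hubs and then permutes the pages v_k w_k, while every permutation of the
-- pages is an automorphism.  A proper colouring gives the hubs distinct colours, which rules
-- out the swap; so it is distinguishing exactly when distinct pages get distinct colour pairs.
-- After renaming colours the hubs get 0 and 1, and with t + 2 colours exactly t² + t + 1 pairs
-- are admissible on a page; hence χ_D(B_n) = t + 3 when t² + t + 1 < n ≤ (t+1)² + (t+1) + 1.
-- As t² + t + 1 ≤ (t + 1)², the two ranges of the theorem are the cases t = m − 1 and t = m.
module Submission where

open import Defs
open import Data.Nat using (ℕ; _≤_; _<_; _+_; _*_)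
open import Data.Product using (_×_)

open import Data.Fin using (Fin; suc; punchIn; punchOut; inject≤; _≟_)
open import Data.Fin.Patterns using (0F; 1F)
open import Data.Fin.Permutation
  using (Permutation′; _⟨$⟩ʳ_; _⟨$⟩ˡ_; inverseˡ; inverseʳ; transpose; insert; insert-punchIn)
  renaming (id to idₚ)
open import Data.Fin.Properties
  using (suc-injective; punchInᵢ≢i; punchIn-injective; punchIn-punchOut; inject≤-injective;
         injective⇒≤; +↔⊎; *↔×)
open import Data.Nat using (suc; z≤n; s≤s)
open import Data.Nat.Properties
  using (≤-trans; ≤-<-trans; ≤⇒≯; +-mono-≤; *-mono-≤; +-monoʳ-≤; *-monoʳ-≤; n≤1+n; m≤n+m; +-comm; +-suc)
open import Data.Product using (_,_; proj₁; proj₂; ∃; map)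
open import Data.Sum using (_⊎_; inj₁; inj₂)
open import Data.Sum.Function.Propositional using (_⊎-↔_)
open import Function using (_∘_; _↔_; Injection; Inverse)
open import Function.Construct.Composition using (_↔-∘_)
open import Function.Construct.Identity using (↔-id)
open import Function.Definitions using (Injective)
open import Function.Properties.Inverse using (↔⇒↣; ↔-sym)
open import Relation.Binary.PropositionalEquality
  using (_≡_; _≢_; refl; sym; trans; cong; cong₂; subst; subst₂; module ≡-Reasoning)
open import Relation.Nullary using (¬_; yes; no)
open import Relation.Nullary.Negation using (contradiction)

pattern V i = 0F , i
pattern W i = 1F , i

other : Fin 2 → Fin 2
other 0F = 1F
other 1F = 0F

hub-rung : ∀ {n} s → Adj {n} (s , 0F) (other s , 0F)
hub-rung 0F = rung 0F
hub-rung 1F = rung′ 0F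

page-neighbour : ∀ {n s k} {y : BookV n} → Adj (s , suc k) y →
                 y ≡ (s , 0F) ⊎ y ≡ (other s , suc k)
page-neighbour (rung _)     = inj₂ refl
page-neighbour (rung′ _)    = inj₂ refl
page-neighbour (spoke′ _ _) = inj₁ refl

hub-neighbour : ∀ {n s} {y : BookV n} → Adj (s , 0F) y →
                y ≡ (other s , 0F) ⊎ ∃ λ k → y ≡ (s , suc k)
hub-neighbour (rung _)    = inj₁ refl
hub-neighbour (rung′ _)   = inj₁ refl
hub-neighbour (spoke _ k) = inj₂ (k , refl)

three-neighbours⇒hub : ∀ {n} {x y z u : BookV n} → Adj x y → Adj x z → Adj x u →
                       y ≢ z → y ≢ u → z ≢ u → proj₂ x ≡ 0F
three-neighbours⇒hub {x = _ , 0F}    _ _ _ _   _   _   = refl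
three-neighbours⇒hub {x = _ , suc _} a b c y≢z y≢u z≢u
  with page-neighbour a | page-neighbour b | page-neighbour c
... | inj₁ refl | inj₁ refl | _         = contradiction refl y≢z
... | inj₂ refl | inj₂ refl | _         = contradiction refl y≢z
... | inj₁ refl | inj₂ refl | inj₁ refl = contradiction refl y≢u
... | inj₁ refl | inj₂ refl | inj₂ refl = contradiction refl z≢u
... | inj₂ refl | inj₁ refl | inj₁ refl = contradiction refl z≢u
... | inj₂ refl | inj₁ refl | inj₂ refl = contradiction refl y≢u

rung-index : ∀ {n} {i j : Fin (suc n)} → Adj {n} (V i) (W j) → i ≡ j
rung-index (rung _) = refl

to-injective : ∀ {n} (σ : Aut n) → Injective _≡_ _≡_ (Aut.to σ)
to-injective σ {x} {y} eq = trans (sym (from-to x)) (trans (cong from eq) (from-to y))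
  where open Aut σ

hub↦hub : ∀ {n} (σ : Aut (2 + n)) s → proj₂ (Aut.to σ (s , 0F)) ≡ 0F
hub↦hub σ s = three-neighbours⇒hub (adj→ (hub-rung s)) (adj→ (spoke s 0F)) (adj→ (spoke s 1F))
  ((λ ()) ∘ cong proj₂ ∘ to-injective σ)
  ((λ ()) ∘ cong proj₂ ∘ to-injective σ)
  ((λ ()) ∘ cong proj₂ ∘ to-injective σ)
  where open Aut σ

pageColors : ∀ {n r} → Coloring n r → Fin n → Fin r × Fin r
pageColors c k = c (V (suc k)) , c (W (suc k))

module _ {n r} {c : Coloring (2 + n) r} (hubs≢ : c (V 0F) ≢ c (W 0F))
         (pages-injective : Injective _≡_ _≡_ (pageColors c))
         (σ : Aut (2 + n)) (preserves : ∀ x → c (Aut.to σ x) ≡ c x) where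
  open Aut σ

  hub-colour-injective : ∀ {s s′} → c (s′ , 0F) ≡ c (s , 0F) → s′ ≡ s
  hub-colour-injective {0F} {0F} _  = refl
  hub-colour-injective {0F} {1F} eq = contradiction (sym eq) hubs≢
  hub-colour-injective {1F} {0F} eq = contradiction eq hubs≢
  hub-colour-injective {1F} {1F} _  = refl

  hub-fixed : ∀ s → to (s , 0F) ≡ (s , 0F)
  hub-fixed s with to (s , 0F) | hub↦hub σ s | preserves (s , 0F)
  ... | s′ , 0F | refl | eq = cong (_, 0F) (hub-colour-injective eq)

  side-preserved : ∀ s k → ∃ λ k′ → to (s , suc k) ≡ (s , suc k′)
  side-preserved s k
    with hub-neighbour (subst (λ h → Adj h (to (s , suc k))) (hub-fixed s) (adj→ (spoke s k)))
  ... | inj₂ moved = moved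
  ... | inj₁ eq    = contradiction (to-injective σ (trans eq (sym (hub-fixed (other s))))) λ ()

  recoloured : ∀ {x y} → to x ≡ y → c y ≡ c x
  recoloured {x} refl = preserves x

  page-fixed : ∀ k → to (V (suc k)) ≡ V (suc k) × to (W (suc k)) ≡ W (suc k)
  page-fixed k with side-preserved 0F k | side-preserved 1F k
  ... | k′ , eqᵛ | k″ , eqʷ with rung-index (subst₂ Adj eqᵛ eqʷ (adj→ (rung (suc k))))
  ... | refl with pages-injective {k′} {k} (cong₂ _,_ (recoloured eqᵛ) (recoloured eqʷ))
  ... | refl = eqᵛ , eqʷ

  fixes : ∀ x → to x ≡ x
  fixes (s , 0F)    = hub-fixed s
  fixes (V (suc k)) = proj₁ (page-fixed k)
  fixes (W (suc k)) = proj₂ (page-fixed k)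

distinct-pages⇒distinguishing : ∀ {n r} {c : Coloring (2 + n) r} → c (V 0F) ≢ c (W 0F) →
                                Injective _≡_ _≡_ (pageColors c) → Distinguishing c
distinct-pages⇒distinguishing = fixes

relabel : ∀ {n} → (Fin n → Fin n) → BookV n → BookV n
relabel f (s , 0F)    = s , 0F
relabel f (s , suc k) = s , suc (f k)

relabel-adj : ∀ {n} (f : Fin n → Fin n) {x y} → Adj x y → Adj (relabel f x) (relabel f y)
relabel-adj f (rung 0F)        = rung 0F
relabel-adj f (rung (suc k))   = rung (suc (f k))
relabel-adj f (rung′ 0F)       = rung′ 0F
relabel-adj f (rung′ (suc k))  = rung′ (suc (f k))
relabel-adj f (spoke s k)      = spoke s (f k)
relabel-adj f (spoke′ s k)     = spoke′ s (f k)

relabel-inverse : ∀ {n} {f g : Fin n → Fin n} → (∀ k → g (f k) ≡ k) →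
                  ∀ x → relabel g (relabel f x) ≡ x
relabel-inverse g∘f≡id (s , 0F)    = refl
relabel-inverse g∘f≡id (s , suc k) = cong (λ k′ → s , suc k′) (g∘f≡id k)

pageAut : ∀ {n} → Permutation′ n → Aut n
pageAut π = record
  { to      = relabel (π ⟨$⟩ʳ_)
  ; from    = relabel (π ⟨$⟩ˡ_)
  ; from-to = from-to
  ; to-from = relabel-inverse (λ _ → inverseʳ π)
  ; adj→    = relabel-adj _
  ; adj←    = λ {x} {y} adj → subst₂ Adj (from-to x) (from-to y) (relabel-adj _ adj)
  }
  where
  from-to : ∀ x → relabel (π ⟨$⟩ˡ_) (relabel (π ⟨$⟩ʳ_) x) ≡ x
  from-to = relabel-inverse (λ _ → inverseˡ π)

transpose-matchˡ : ∀ {n} (i j : Fin n) → transpose i j ⟨$⟩ʳ i ≡ j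
transpose-matchˡ i j with i ≟ i
... | yes _  = refl
... | no i≢i = contradiction refl i≢i

transpose-invariant : ∀ {n} {A : Set} (f : Fin n → A) {i j} → f i ≡ f j →
                      ∀ k → f (transpose i j ⟨$⟩ʳ k) ≡ f k
transpose-invariant f {i} {j} fi≡fj k with k ≟ i
... | yes refl = sym fi≡fj
... | no _ with k ≟ j
...   | yes refl = fi≡fj
...   | no _     = refl

distinguishing⇒distinct-pages : ∀ {n r} {c : Coloring n r} → Distinguishing c →
                                Injective _≡_ _≡_ (pageColors c)
distinguishing⇒distinct-pages {c = c} distinguishing {i} {j} same-colours =
  trans (sym (suc-injective (cong proj₂ (distinguishing (pageAut (transpose i j)) preserves (V (suc i))))))
        (transpose-matchˡ i j)
  where
  preserves : ∀ x → c (relabel (transpose i j ⟨$⟩ʳ_) x) ≡ c x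
  preserves (s , 0F)    = refl
  preserves (V (suc k)) = cong proj₁ (transpose-invariant (pageColors c) same-colours k)
  preserves (W (suc k)) = cong proj₂ (transpose-invariant (pageColors c) same-colours k)

-- With 2 + t colours and hub colours a ≠ b, a page v_k w_k takes colours (x , y) with
-- x ≠ a, y ≠ b, x ≠ y: either x = b and y is one of 1 + t colours, or x ∉ {a , b}
-- and y ∉ {b , x}, in t² ways.
pageColorings : ℕ → ℕ
pageColorings t = suc t + t * t

ProperPage : ∀ {r} → Fin r → Fin r → Fin r × Fin r → Set
ProperPage a b (x , y) = x ≢ a × y ≢ b × x ≢ y

PageCode : ℕ → Set
PageCode t = Fin (suc t) ⊎ Fin t × Fin t

pageCode↔ : ∀ {t} → Fin (pageColorings t) ↔ PageCode t
pageCode↔ = (↔-id _ ⊎-↔ *↔×) ↔-∘ +↔⊎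

decode : ∀ {t} → PageCode t → Fin (2 + t) × Fin (2 + t)
decode (inj₁ y)       = 1F , punchIn 1F y
decode (inj₂ (x , y)) = suc (suc x) , punchIn 1F (punchIn (suc x) y)

decode-proper : ∀ {t} (u : PageCode t) → ProperPage 0F 1F (decode u)
decode-proper (inj₁ y)       = (λ ()) , punchInᵢ≢i 1F y , punchInᵢ≢i 1F y ∘ sym
decode-proper (inj₂ (x , y)) =
  (λ ()) , punchInᵢ≢i 1F _ , λ eq → punchInᵢ≢i (suc x) y (sym (punchIn-injective 1F _ _ eq))

decode-injective : ∀ {t} → Injective _≡_ _≡_ (decode {t})
decode-injective {x = inj₁ y} {inj₁ y′} eq = cong inj₁ (punchIn-injective 1F y y′ (cong proj₂ eq))
decode-injective {x = inj₂ (x , y)} {inj₂ (x′ , y′)} eq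
  with suc-injective (suc-injective (cong proj₁ eq))
... | refl = cong (λ y″ → inj₂ (x , y″))
                  (punchIn-injective (suc x) y y′ (punchIn-injective 1F _ _ (cong proj₂ eq)))
decode-injective {x = inj₁ _} {inj₂ _} ()
decode-injective {x = inj₂ _} {inj₁ _} ()

decode-surjective : ∀ {t} {p : Fin (2 + t) × Fin (2 + t)} → ProperPage 0F 1F p →
                    ∃ λ u → decode u ≡ p
decode-surjective {p = 0F , y} (x≢0 , _ , _) = contradiction refl x≢0
decode-surjective {p = 1F , y} (_ , y≢1 , _) =
  inj₁ (punchOut (y≢1 ∘ sym)) , cong (1F ,_) (punchIn-punchOut _)
decode-surjective {p = suc (suc x) , y} (_ , y≢1 , x≢y) =
  inj₂ (x , punchOut x′≢y′) , cong (suc (suc x) ,_) (begin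
    punchIn 1F (punchIn (suc x) (punchOut x′≢y′)) ≡⟨ cong (punchIn 1F) (punchIn-punchOut x′≢y′) ⟩
    punchIn 1F y′                                 ≡⟨ punchIn-punchOut _ ⟩
    y                                             ∎)
  where
  open ≡-Reasoning
  y′ = punchOut (y≢1 ∘ sym)
  x′≢y′ : suc x ≢ y′
  x′≢y′ eq = x≢y (trans (cong (punchIn 1F) eq) (punchIn-punchOut _))

properPage-map : ∀ {r s} {f : Fin r → Fin s} → Injective _≡_ _≡_ f → ∀ {a b p} →
                 ProperPage a b p → ProperPage (f a) (f b) (map f f p)
properPage-map f-injective (x≢a , y≢b , x≢y) =
  x≢a ∘ f-injective , y≢b ∘ f-injective , x≢y ∘ f-injective

insert-matchˡ : ∀ {m} (i j : Fin (suc m)) (π : Permutation′ m) → insert i j π ⟨$⟩ʳ i ≡ j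
insert-matchˡ i j π with i ≟ i
... | yes _  = refl
... | no i≢i = contradiction refl i≢i

module _ {t} {a b : Fin (2 + t)} (a≢b : a ≢ b) where

  hubNormaliser : Permutation′ (2 + t)
  hubNormaliser = insert a 0F (insert (punchOut a≢b) 0F idₚ)

  hubNormaliser-a : hubNormaliser ⟨$⟩ʳ a ≡ 0F
  hubNormaliser-a = insert-matchˡ a 0F _

  hubNormaliser-b : hubNormaliser ⟨$⟩ʳ b ≡ 1F
  hubNormaliser-b = begin
    hubNormaliser ⟨$⟩ʳ b                              ≡⟨ cong (hubNormaliser ⟨$⟩ʳ_) (punchIn-punchOut a≢b) ⟨
    hubNormaliser ⟨$⟩ʳ punchIn a (punchOut a≢b)       ≡⟨ insert-punchIn a 0F _ _ ⟩
    suc (insert (punchOut a≢b) 0F idₚ ⟨$⟩ʳ punchOut a≢b) ≡⟨ cong suc (insert-matchˡ (punchOut a≢b) 0F idₚ) ⟩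
    1F                                                ∎
    where open ≡-Reasoning

  hubNormaliser-injective : Injective _≡_ _≡_ (hubNormaliser ⟨$⟩ʳ_)
  hubNormaliser-injective = Injection.injective (↔⇒↣ hubNormaliser)

  normalise : ∀ {p} → ProperPage a b p →
              ProperPage 0F 1F (map (hubNormaliser ⟨$⟩ʳ_) (hubNormaliser ⟨$⟩ʳ_) p)
  normalise {p} P = subst₂ (λ a′ b′ → ProperPage a′ b′ (map π π p)) hubNormaliser-a hubNormaliser-b
                           (properPage-map hubNormaliser-injective P)
    where π = hubNormaliser ⟨$⟩ʳ_

  pageCode : ∀ {p} → ProperPage a b p → Fin (pageColorings t)
  pageCode P = Inverse.from pageCode↔ (proj₁ (decode-surjective (normalise P)))

  pageCode-injective : ∀ {p q} (P : ProperPage a b p) (Q : ProperPage a b q) →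
                       pageCode P ≡ pageCode Q → p ≡ q
  pageCode-injective P Q eq = cong₂ _,_ (hubNormaliser-injective (cong proj₁ normalised≡))
                                        (hubNormaliser-injective (cong proj₂ normalised≡))
    where
    normalised≡ = trans (sym (proj₂ (decode-surjective (normalise P))))
                        (trans (cong decode (Injection.injective (↔⇒↣ (↔-sym pageCode↔)) eq))
                               (proj₂ (decode-surjective (normalise Q))))

proper⇒properPage : ∀ {n r} {c : Coloring n r} → Proper c →
                    ∀ k → ProperPage (c (V 0F)) (c (W 0F)) (pageColors c k)
proper⇒properPage proper k = proper (spoke′ 0F k) , proper (spoke′ 1F k) , proper (rung (suc k))

bookColoring : ∀ {n r} → Fin r → Fin r → (Fin n → Fin r × Fin r) → Coloring n r
bookColoring a b pages (V 0F)      = a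
bookColoring a b pages (W 0F)      = b
bookColoring a b pages (V (suc k)) = proj₁ (pages k)
bookColoring a b pages (W (suc k)) = proj₂ (pages k)

bookColoring-proper : ∀ {n r} {a b : Fin r} {pages : Fin n → Fin r × Fin r} → a ≢ b →
                      (∀ k → ProperPage a b (pages k)) → Proper (bookColoring a b pages)
bookColoring-proper a≢b proper (rung 0F)          = a≢b
bookColoring-proper a≢b proper (rung′ 0F)         = a≢b ∘ sym
bookColoring-proper a≢b proper (rung (suc k))     = proj₂ (proj₂ (proper k))
bookColoring-proper a≢b proper (rung′ (suc k))    = proj₂ (proj₂ (proper k)) ∘ sym
bookColoring-proper a≢b proper (spoke 0F k)       = proj₁ (proper k) ∘ sym
bookColoring-proper a≢b proper (spoke 1F k)       = proj₁ (proj₂ (proper k)) ∘ sym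
bookColoring-proper a≢b proper (spoke′ 0F k)      = proj₁ (proper k)
bookColoring-proper a≢b proper (spoke′ 1F k)      = proj₁ (proj₂ (proper k))

hasPDC⇒≤ : ∀ {n t} → HasPDC n (2 + t) → n ≤ pageColorings t
hasPDC⇒≤ (c , proper , distinguishing) =
  injective⇒≤ λ {i} {j} eq → distinguishing⇒distinct-pages distinguishing
    (pageCode-injective hubs≢ (proper⇒properPage proper i) (proper⇒properPage proper j) eq)
  where
  hubs≢ = proper (rung 0F)

≤⇒hasPDC : ∀ {n t} → 2 + n ≤ pageColorings t → HasPDC (2 + n) (2 + t)
≤⇒hasPDC {n} {t} n≤ = bookColoring 0F 1F pages
                    , bookColoring-proper (λ ()) (decode-proper ∘ code)
                    , distinct-pages⇒distinguishing (λ ()) pages-injective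
  where
  code : Fin (2 + n) → PageCode t
  code k = Inverse.to pageCode↔ (inject≤ k n≤)
  pages = decode ∘ code
  pages-injective : Injective _≡_ _≡_ pages
  pages-injective eq =
    inject≤-injective n≤ n≤ _ _ (Injection.injective (↔⇒↣ pageCode↔) (decode-injective eq))

¬hasPDC<2 : ∀ {n r} → r < 2 → ¬ HasPDC n r
¬hasPDC<2 {r = 0} _ (c , _) with c (V 0F)
... | ()
¬hasPDC<2 {r = 1} _ (c , proper , _) with c (V 0F) | c (W 0F) | proper (rung 0F)
... | 0F | 0F | 0≢0 = 0≢0 refl
¬hasPDC<2 {r = suc (suc _)} (s≤s (s≤s ()))

pageColorings-mono : ∀ {s t} → s ≤ t → pageColorings s ≤ pageColorings t
pageColorings-mono s≤t = +-mono-≤ (s≤s s≤t) (*-mono-≤ s≤t s≤t)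

pageColorings≤square : ∀ m → pageColorings m ≤ suc m * suc m
pageColorings≤square m = +-monoʳ-≤ (suc m) (*-monoʳ-≤ m (n≤1+n m))

square≤pageColorings : ∀ m → suc m * suc m ≤ pageColorings (suc m)
square≤pageColorings m = m≤n+m (suc m * suc m) (2 + m)

pageColorings-quadratic : ∀ m → m * m + m + 1 ≡ pageColorings m
pageColorings-quadratic m = trans (+-comm (m * m + m) 1) (cong suc (+-comm (m * m) m))

chiD≡3+t : ∀ {n} t → pageColorings t < n → n ≤ pageColorings (suc t) → ChiD≡ n (3 + t)
chiD≡3+t {0} t () _
chiD≡3+t {1} t (s≤s ()) _
chiD≡3+t {suc (suc n)} t Kt<n n≤Kt+1 = ≤⇒hasPDC n≤Kt+1 , fewer
  where
  fewer : ∀ r → r < 3 + t → ¬ HasPDC (2 + n) r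
  fewer 0 _ = ¬hasPDC<2 (s≤s z≤n)
  fewer 1 _ = ¬hasPDC<2 (s≤s (s≤s z≤n))
  fewer (suc (suc s)) (s≤s (s≤s (s≤s s≤t))) pdc =
    ≤⇒≯ (≤-trans (hasPDC⇒≤ pdc) (pageColorings-mono s≤t)) Kt<n

theorem5p10 : (n m : ℕ) → 1 ≤ m →
    ((m * m < n → n ≤ m * m + m + 1 → ChiD≡ n (m + 2))
    × (m * m + m + 2 ≤ n → n ≤ (m + 1) * (m + 1) → ChiD≡ n (m + 3)))
theorem5p10 n m@(suc m′) _ = part-i , part-ii
  where
  part-i : m * m < n → n ≤ m * m + m + 1 → ChiD≡ n (m + 2)
  part-i m²<n n≤ = subst (ChiD≡ n) (+-comm 2 m)
    (chiD≡3+t m′ (≤-<-trans (pageColorings≤square m′) m²<n)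
                 (subst (n ≤_) (pageColorings-quadratic m) n≤))
  part-ii : m * m + m + 2 ≤ n → n ≤ (m + 1) * (m + 1) → ChiD≡ n (m + 3)
  part-ii m²+m+2≤n n≤ = subst (ChiD≡ n) (+-comm 3 m)
    (chiD≡3+t m (subst (_≤ n) (trans (+-suc (m * m + m) 1) (cong suc (pageColorings-quadratic m)))
                              m²+m+2≤n)
                (≤-trans (subst (λ k → n ≤ k * k) (+-comm m 1) n≤) (square≤pageColorings m)))
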